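{- Let $a,b$ be coprime positive integers, $0\le k<b$, and let $Q\in\mathcal{P}$ be $k$-stable. Then $Q$ is not $k$-skeletal if and only if there exists $s\in\{1,\dots,b\}$ such that the min-level point $v_s$ lies on $Q$, the step of $Q$ ending at $v_s$ is an east step, and $Q_{v_s}$ is $k$-stable.
   Context: $\mathcal{P}$ is the set of lattice paths from $(0,0)$ to $(a,b)$ with $b$ unit north steps and $a$ unit east steps. The level of a lattice point $(x,y)$ is $ay-bx$. For a lattice point $v$ on $Q$, $Q_v$ is the path from the origin whose steps are those of $Q$ from $v$ to $(a,b)$ followed by those of $Q$ from $(0,0)$ to $v$. $Q$ is $k$-stable if its last $k+1$ north steps start at points of level $\ge0$; $Q$ is $k$-skeletal if it is $k$-stable and $Q_v$ is not $k$-stable for every lattice point $v$ on $Q$ of level $>0$. The min-level points are $v_s=(\lfloor sa/b\rfloor, s)$ for $s=1,\dots,b-1$ and $v_b=(a-1,b)$. -}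

module Defs where

open import Data.Nat using (ℕ; zero; suc; _+_; _*_; _∸_; _≤_; _<_; NonZero)
open import Data.Nat.DivMod using (_/_)
open import Data.Integer as ℤ using (ℤ; +_; _-_)
open import Data.List using (List; []; _∷_; length; take; drop; _++_)
open import Data.Maybe using (Maybe; just; nothing)
open import Data.Product using (_×_; _,_)
open import Data.Bool using (if_then_else_)
open import Relation.Nullary.Decidable using (⌊_⌋)
open import Data.Nat using (_<?_)

data Step : Set where
  N E : Step

#N : List Step → ℕ
#N []       = 0
#N (N ∷ q) = suc (#N q)
#N (E ∷ q) = #N q

#E : List Step → ℕ
#E []       = 0
#E (N ∷ q) = #E q
#E (E ∷ q) = suc (#E q)

IsPath : ℕ → ℕ → List Step → Set
IsPath a b Q = (#E Q ≡ a) × (#N Q ≡ b)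
  where open import Relation.Binary.PropositionalEquality using (_≡_)

pointAt : List Step → ℕ → ℕ × ℕ
pointAt Q i = (#E (take i Q) , #N (take i Q))

_!!_ : List Step → ℕ → Maybe Step
[]      !! _     = nothing
(s ∷ _) !! zero  = just s
(_ ∷ q) !! suc j = q !! j

level : ℕ → ℕ → ℕ × ℕ → ℤ
level a b (x , y) = + (a * y) - + (b * x)

-- Q_v where v = pointAt Q i: steps of Q from v to (a,b), then from (0,0) to v
rotate : ℕ → List Step → List Step
rotate i Q = drop i Q ++ take i Q

-- k-stable: every north step among the last k+1 north steps (i.e. a north step
-- with at most k north steps after it) starts at a point of level ≥ 0.
KStable : ℕ → ℕ → ℕ → List Step → Set
KStable a b k Q =
  ∀ j → Q !! j ≡ just N → #N (drop (suc j) Q) ≤ k → ℤ.0ℤ ℤ.≤ level a b (pointAt Q j)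
  where open import Relation.Binary.PropositionalEquality using (_≡_)

-- k-skeletal: k-stable, and Q_v is not k-stable for every lattice point v on Q
-- of level > 0 (points on Q are exactly pointAt Q i for i ≤ length Q).
KSkeletal : ℕ → ℕ → ℕ → List Step → Set
KSkeletal a b k Q =
  KStable a b k Q ×
  (∀ i → i ≤ length Q → ℤ.0ℤ ℤ.< level a b (pointAt Q i) → ¬ KStable a b k (rotate i Q))
  where open import Relation.Nullary using (¬_)

vmin : (a b : ℕ) → .{{NonZero b}} → ℕ → ℕ × ℕ
vmin a b s = if ⌊ s <? b ⌋ then ((s * a) / b , s) else (a ∸ 1 , b)

{-# OPTIONS --safe #-}
-- Levels along a path rise by a on a north step and drop by b on an east step, and a path in 𝒫
-- returns to level 0. If Q is not k-skeletal, some k-stable rotation Q_v starts at a point v of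
-- positive level. Walk along Q from v to the first point w of level ≤ b: every point strictly
-- between lies above level b, so w is no higher than any point of the walk, and rotating on to w
-- keeps the path k-stable. A closed k-stable path cannot end with a north step (that step would
-- start at level -a), so w ends an east step, and since its predecessor lies above level b (or
-- w = v), w has level in (0, b]. By coprimality the points of level in (0, b] at heights 1, …, b
-- are exactly the min-level points v_s. Conversely every v_s has positive level, so a k-stable
-- Q_{v_s} shows that Q is not k-skeletal.
module Submission where

open import Defs
open import Data.Nat
  using (ℕ; zero; suc; _+_; _*_; _∸_; _≤_; _<_; z≤n; s≤s; _<?_; _≤?_; NonZero; >-nonZero; >-nonZero⁻¹)
open import Data.Nat.Properties
  using ( ≤-trans; ≤-antisym; ≤-pred; <⇒≤; <⇒≱; ≮⇒≥; ≤∧≢⇒<; n≮0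
        ; +-comm; *-comm; *-zeroʳ; *-suc; *-cancelˡ-<; *-cancelˡ-≤; *-monoʳ-<
        ; ∸-monoʳ-<; m<n⇒0<n∸m; anyUpTo?; allUpTo?)
open import Data.Nat.DivMod using (_/_; m/n*n≤m; m<n*o⇒m/o<n; /-monoˡ-≤; m*n/n≡m)
open import Data.Nat.Divisibility using (_∤_; divides; ∣⇒≤)
open import Data.Nat.Coprimality using (Coprime; coprime-divisor)
import Data.Nat.Coprimality as Coprimality
open import Data.Integer as ℤ using (ℤ; +_; 0ℤ; +≤+; +<+)
import Data.Integer.Properties as ℤP
open import Data.Integer.Tactic.RingSolver using (solve-∀)
open import Data.List using (List; []; _∷_; [_]; _++_; _∷ʳ_; length; take; drop; initLast; _∷ʳ′_)
open import Data.List.Properties using (++-assoc; ++-identityʳ; ∷-injective; ∷ʳ-++; take++drop≡id)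
open import Data.Maybe using (just)
open import Data.Maybe.Properties using (≡-dec)
open import Data.Product using (_×_; _,_; proj₁; proj₂; ∃-syntax; ∃₂)
open import Data.Sum using (_⊎_; inj₁; inj₂)
open import Data.Empty using (⊥-elim)
open import Relation.Nullary using (¬_; Dec; yes; no; contradiction)
open import Relation.Nullary.Decidable using (map′; _×-dec_; _→-dec_)
open import Relation.Unary using (Decidable)
open import Relation.Binary.Definitions using (DecidableEquality)
open import Relation.Binary.PropositionalEquality
  using (_≡_; _≢_; refl; sym; trans; cong; cong₂; subst; subst₂; module ≡-Reasoning)
open import Function.Bundles using (_⇔_; mk⇔)

take-length-++ : ∀ {A : Set} (xs ys : List A) → take (length xs) (xs ++ ys) ≡ xs
take-length-++ []       ys = refl
take-length-++ (x ∷ xs) ys = cong (x ∷_) (take-length-++ xs ys)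

take-suc-length-++ : ∀ {A : Set} (xs : List A) y ys →
                     take (suc (length xs)) (xs ++ y ∷ ys) ≡ xs ∷ʳ y
take-suc-length-++ []       y ys = refl
take-suc-length-++ (x ∷ xs) y ys = cong (x ∷_) (take-suc-length-++ xs y ys)

drop-suc-length-++ : ∀ {A : Set} (xs : List A) y ys → drop (suc (length xs)) (xs ++ y ∷ ys) ≡ ys
drop-suc-length-++ []       y ys = refl
drop-suc-length-++ (x ∷ xs) y ys = drop-suc-length-++ xs y ys

++≡++∷-cases : ∀ {A : Set} (ys xs zs : List A) {w ws} → ys ++ xs ≡ zs ++ w ∷ ws →
               (∃[ ys₂ ] (ys ≡ zs ++ w ∷ ys₂ × ws ≡ ys₂ ++ xs)) ⊎
               (∃[ xs₁ ] (xs ≡ xs₁ ++ w ∷ ws × zs ≡ ys ++ xs₁))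
++≡++∷-cases []       xs zs       eq   = inj₂ (zs , eq , refl)
++≡++∷-cases (y ∷ ys) xs []       refl = inj₁ (ys , refl , refl)
++≡++∷-cases (y ∷ ys) xs (z ∷ zs) eq
  with refl , eq′ ← ∷-injective eq | ++≡++∷-cases ys xs zs eq′
... | inj₁ (ys₂ , refl , refl) = inj₁ (ys₂ , refl , refl)
... | inj₂ (xs₁ , refl , refl) = inj₂ (xs₁ , refl , refl)

shortestPrefix : ∀ {A : Set} {P : List A → Set} → Decidable P → ∀ ys → P ys →
                 ∃₂ λ ys₁ ys₂ → ys ≡ ys₁ ++ ys₂ × P ys₁ ×
                                (∀ zs z zs′ → ys₁ ≡ zs ++ z ∷ zs′ → ¬ P zs)
shortestPrefix P? ys Pys with P? []
... | yes P[] = [] , ys , refl , P[] , λ { [] _ _ () ; (_ ∷ _) _ _ () }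
shortestPrefix P? []       P[]  | no ¬P[] = contradiction P[] ¬P[]
shortestPrefix {P = P} P? (y ∷ ys) Pyys | no ¬P[]
  with ys₁ , ys₂ , refl , Pyys₁ , shortest ← shortestPrefix (λ zs → P? (y ∷ zs)) ys Pyys
  = y ∷ ys₁ , ys₂ , refl , Pyys₁ , shortest′
  where
  shortest′ : ∀ zs z zs′ → y ∷ ys₁ ≡ zs ++ z ∷ zs′ → ¬ P zs
  shortest′ []       _ _   _  = ¬P[]
  shortest′ (_ ∷ zs) z zs′ eq with refl , eq′ ← ∷-injective eq = shortest zs z zs′ eq′

_≟ₛ_ : DecidableEquality Step
N ≟ₛ N = yes refl
N ≟ₛ E = no λ ()
E ≟ₛ N = no λ ()
E ≟ₛ E = yes refl

!!-length-++ : ∀ X s Y → (X ++ s ∷ Y) !! length X ≡ just s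
!!-length-++ []      s Y = refl
!!-length-++ (_ ∷ X) s Y = !!-length-++ X s Y

!!-just⇒< : ∀ Q j {s} → Q !! j ≡ just s → j < length Q
!!-just⇒< (_ ∷ Q) zero    _  = s≤s z≤n
!!-just⇒< (_ ∷ Q) (suc j) eq = s≤s (!!-just⇒< Q j eq)

!!-split : ∀ Q j {s} → Q !! j ≡ just s → Q ≡ take j Q ++ s ∷ drop (suc j) Q
!!-split (_ ∷ Q) zero    refl = refl
!!-split (x ∷ Q) (suc j) eq   = cong (x ∷_) (!!-split Q j eq)

#N-++-≤ˡ : ∀ X Y → #N X ≤ #N (X ++ Y)
#N-++-≤ˡ []      Y = z≤n
#N-++-≤ˡ (N ∷ X) Y = s≤s (#N-++-≤ˡ X Y)
#N-++-≤ˡ (E ∷ X) Y = #N-++-≤ˡ X Y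

+-cancelˡ-< : ∀ i {j k} → i ℤ.+ j ℤ.< i ℤ.+ k → j ℤ.< k
+-cancelˡ-< i {j} {k} lt =
  subst₂ ℤ._<_ (-i+[i+j]≡j i j) (-i+[i+j]≡j i k) (ℤP.+-monoʳ-< (ℤ.- i) lt)
  where
  -i+[i+j]≡j : ∀ i j → ℤ.- i ℤ.+ (i ℤ.+ j) ≡ j
  -i+[i+j]≡j = solve-∀

n<m⇒0<+m-+n : ∀ {m n} → n < m → 0ℤ ℤ.< + m ℤ.- + n
n<m⇒0<+m-+n {m} {n} n<m
  rewrite ℤP.[+m]-[+n]≡m⊖n m n | ℤP.⊖-≥ (<⇒≤ n<m) = +<+ (m<n⇒0<n∸m n<m)

0<+m-+n⇒n<m : ∀ {m n} → 0ℤ ℤ.< + m ℤ.- + n → n < m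
0<+m-+n⇒n<m {m} {n} pos with n <? m
... | yes n<m = n<m
... | no  n≮m = ⊥-elim (ℤP.<⇒≱ pos (ℤP.i≤j⇒i-j≤0 (+≤+ (≮⇒≥ n≮m))))

+m-+n≤+c⇒m≤n+c : ∀ {m n c} → + m ℤ.- + n ℤ.≤ + c → m ≤ n + c
+m-+n≤+c⇒m≤n+c {m} {n} {c} le =
  ℤP.drop‿+≤+ (subst₂ ℤ._≤_ ([i-j]+j≡i (+ m) (+ n)) [+c]+[+n]≡+[n+c] (ℤP.+-monoˡ-≤ (+ n) le))
  where
  [i-j]+j≡i : ∀ i j → i ℤ.- j ℤ.+ j ≡ i
  [i-j]+j≡i = solve-∀
  [+c]+[+n]≡+[n+c] : + c ℤ.+ + n ≡ + (n + c)
  [+c]+[+n]≡+[n+c] = trans (ℤP.+-comm (+ c) (+ n)) (sym (ℤP.pos-+ n c))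

module _ (a b : ℕ) where

  weight : Step → ℤ
  weight N = + a
  weight E = ℤ.- + b

  height : List Step → ℤ
  height []      = 0ℤ
  height (s ∷ Z) = weight s ℤ.+ height Z

  -b≤weight : ∀ s → ℤ.- + b ℤ.≤ weight s
  -b≤weight N = ℤP.neg-≤-pos
  -b≤weight E = ℤP.≤-refl

  height-++ : ∀ X Y → height (X ++ Y) ≡ height X ℤ.+ height Y
  height-++ []      Y = sym (ℤP.+-identityˡ (height Y))
  height-++ (s ∷ X) Y =
    trans (cong (λ h → weight s ℤ.+ h) (height-++ X Y))
          (sym (ℤP.+-assoc (weight s) (height X) (height Y)))

  height-++-comm : ∀ X Y → height (X ++ Y) ≡ height (Y ++ X)
  height-++-comm X Y = trans (height-++ X Y) (trans (ℤP.+-comm (height X) (height Y)) (sym (height-++ Y X)))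

  height-∷ʳ : ∀ X s → height (X ∷ʳ s) ≡ height X ℤ.+ weight s
  height-∷ʳ X s = trans (height-++ X [ s ]) (cong (λ h → height X ℤ.+ h) (ℤP.+-identityʳ (weight s)))

  level-north : ∀ x y → level a b (x , suc y) ≡ + a ℤ.+ level a b (x , y)
  level-north x y = begin
    + (a * suc y) ℤ.- + (b * x)        ≡⟨ cong (λ n → + n ℤ.- + (b * x)) (*-suc a y) ⟩
    + (a + a * y) ℤ.- + (b * x)        ≡⟨ cong (ℤ._- + (b * x)) (ℤP.pos-+ a (a * y)) ⟩
    + a ℤ.+ + (a * y) ℤ.- + (b * x)    ≡⟨ ℤP.+-assoc (+ a) (+ (a * y)) (ℤ.- + (b * x)) ⟩
    + a ℤ.+ level a b (x , y)          ∎
    where open ≡-Reasoning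

  level-east : ∀ x y → level a b (suc x , y) ≡ ℤ.- + b ℤ.+ level a b (x , y)
  level-east x y = begin
    + (a * y) ℤ.- + (b * suc x)        ≡⟨ cong (λ n → + (a * y) ℤ.- + n) (*-suc b x) ⟩
    + (a * y) ℤ.- + (b + b * x)        ≡⟨ cong (λ i → + (a * y) ℤ.- i) (ℤP.pos-+ b (b * x)) ⟩
    + (a * y) ℤ.- (+ b ℤ.+ + (b * x))  ≡⟨ i-[j+k]≡-j+[i-k] (+ (a * y)) (+ b) (+ (b * x)) ⟩
    ℤ.- + b ℤ.+ level a b (x , y)      ∎
    where
    open ≡-Reasoning
    i-[j+k]≡-j+[i-k] : ∀ i j k → i ℤ.- (j ℤ.+ k) ≡ ℤ.- j ℤ.+ (i ℤ.- k)
    i-[j+k]≡-j+[i-k] = solve-∀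

  level≡height : ∀ Z → level a b (#E Z , #N Z) ≡ height Z
  level≡height []      rewrite *-zeroʳ a | *-zeroʳ b = refl
  level≡height (N ∷ Z) = trans (level-north (#E Z) (#N Z)) (cong (λ h → + a ℤ.+ h) (level≡height Z))
  level≡height (E ∷ Z) = trans (level-east (#E Z) (#N Z)) (cong (λ h → ℤ.- + b ℤ.+ h) (level≡height Z))

  level-pointAt : ∀ Q t → level a b (pointAt Q t) ≡ height (take t Q)
  level-pointAt Q t = level≡height (take t Q)

  IsPath⇒height≡0 : ∀ Q → IsPath a b Q → height Q ≡ 0ℤ
  IsPath⇒height≡0 Q (#E≡a , #N≡b) = begin
    height Q                    ≡⟨ sym (level≡height Q) ⟩
    level a b (#E Q , #N Q)     ≡⟨ cong₂ (λ x y → level a b (x , y)) #E≡a #N≡b ⟩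
    + (a * b) ℤ.- + (b * a)     ≡⟨ cong (λ n → + (a * b) ℤ.- + n) (*-comm b a) ⟩
    + (a * b) ℤ.- + (a * b)     ≡⟨ ℤP.+-inverseʳ (+ (a * b)) ⟩
    0ℤ                          ∎
    where open ≡-Reasoning

  KStable′ : ℕ → List Step → Set
  KStable′ k Q = ∀ X Y → Q ≡ X ++ N ∷ Y → #N Y ≤ k → 0ℤ ℤ.≤ height X

  KStable⇒KStable′ : ∀ {k} Q → KStable a b k Q → KStable′ k Q
  KStable⇒KStable′ {k} _ stable X Y refl #NY≤k =
    subst (0ℤ ℤ.≤_) levelX (stable (length X) (!!-length-++ X N Y) #N≤k)
    where
    levelX : level a b (pointAt (X ++ N ∷ Y) (length X)) ≡ height X
    levelX = trans (level-pointAt (X ++ N ∷ Y) (length X)) (cong height (take-length-++ X (N ∷ Y)))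
    #N≤k : #N (drop (suc (length X)) (X ++ N ∷ Y)) ≤ k
    #N≤k = subst (λ Z → #N Z ≤ k) (sym (drop-suc-length-++ X N Y)) #NY≤k

  KStable′⇒KStable : ∀ {k} Q → KStable′ k Q → KStable a b k Q
  KStable′⇒KStable Q stable j Qj≡N #N≤k =
    subst (0ℤ ℤ.≤_) (sym (level-pointAt Q j))
      (stable (take j Q) (drop (suc j) Q) (!!-split Q j Qj≡N) #N≤k)

  KStable? : ∀ k Q → Dec (KStable a b k Q)
  KStable? k Q = map′ (λ below j Qj≡N → below (!!-just⇒< Q j Qj≡N) Qj≡N)
                      (λ stable {j} _ → stable j)
                      (allUpTo? stableAt? (length Q))
    where
    stableAt? : ∀ j → Dec (Q !! j ≡ just N → #N (drop (suc j) Q) ≤ k → 0ℤ ℤ.≤ level a b (pointAt Q j))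
    stableAt? j = ≡-dec _≟ₛ_ (Q !! j) (just N) →-dec (#N (drop (suc j) Q) ≤? k) →-dec (0ℤ ℤP.≤? _)

  EndsAtLowest : List Step → Set
  EndsAtLowest A = ∀ C D → A ≡ C ++ D → height A ℤ.≤ height C

  KStable′-rotate : ∀ {k} A B → height (A ++ B) ≡ 0ℤ → EndsAtLowest A →
                    KStable′ k (A ++ B) → KStable′ k (B ++ A)
  KStable′-rotate A B closed lowest stable X Y eq #NY≤k with ++≡++∷-cases B A X eq
  ... | inj₁ (B₂ , refl , refl) = begin
    0ℤ                         ≤⟨ stable (A ++ X) B₂ (sym (++-assoc A X (N ∷ B₂)))
                                           (≤-trans (#N-++-≤ˡ B₂ A) #NY≤k) ⟩
    height (A ++ X)            ≡⟨ height-++ A X ⟩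
    height A ℤ.+ height X      ≤⟨ ℤP.+-monoˡ-≤ (height X) (lowest [] A refl) ⟩
    0ℤ ℤ.+ height X            ≡⟨ ℤP.+-identityˡ (height X) ⟩
    height X                   ∎
    where open ℤP.≤-Reasoning
  ... | inj₂ (A₁ , refl , refl) = begin
    0ℤ                         ≡⟨ sym (trans (height-++-comm B A) closed) ⟩
    height (B ++ A)            ≡⟨ height-++ B A ⟩
    height B ℤ.+ height A      ≤⟨ ℤP.+-monoʳ-≤ (height B) (lowest A₁ (N ∷ Y) refl) ⟩
    height B ℤ.+ height A₁     ≡⟨ sym (height-++ B A₁) ⟩
    height (B ++ A₁)           ∎
    where open ℤP.≤-Reasoning

  KStable′-rotation-ends-east : .{{NonZero a}} → ∀ {k} Y Z s → height (Z ∷ʳ s ++ Y) ≡ 0ℤ →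
                                KStable′ k (Y ++ Z ∷ʳ s) → s ≡ E
  KStable′-rotation-ends-east Y Z E _      _      = refl
  KStable′-rotation-ends-east Y Z N closed stable = contradiction (begin-strict
    0ℤ                         <⟨ ℤP.+-mono-≤-< (stable (Y ++ Z) [] (sym (++-assoc Y Z [ N ])) z≤n)
                                                 (+<+ (>-nonZero⁻¹ a)) ⟩
    height (Y ++ Z) ℤ.+ + a    ≡⟨ sym (height-∷ʳ (Y ++ Z) N) ⟩
    height ((Y ++ Z) ∷ʳ N)     ≡⟨ cong height (++-assoc Y Z [ N ]) ⟩
    height (Y ++ Z ∷ʳ N)       ≡⟨ height-++-comm Y (Z ∷ʳ N) ⟩
    height (Z ∷ʳ N ++ Y)       ≡⟨ closed ⟩
    0ℤ                         ∎) (ℤP.<-irrefl refl)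
    where open ℤP.≤-Reasoning

  record LowEastCut (k : ℕ) (Q : List Step) : Set where
    field
      before after : List Step
      split        : Q ≡ before ++ E ∷ after
      positive     : 0ℤ ℤ.< height (before ∷ʳ E)
      atMost-b     : height (before ∷ʳ E) ℤ.≤ + b
      stable       : KStable′ k (after ++ before ∷ʳ E)

  lowEastCutAt : .{{NonZero a}} → ∀ {k} Z Y → height (Z ++ Y) ≡ 0ℤ →
                 0ℤ ℤ.< height Z → height Z ℤ.≤ + b → KStable′ k (Y ++ Z) → LowEastCut k (Z ++ Y)
  lowEastCutAt Z Y closed pos low stable with initLast Z
  ... | [] = contradiction pos (ℤP.<-irrefl refl)
  ... | Z′ ∷ʳ′ s with refl ← KStable′-rotation-ends-east Y Z′ s closed stable = record
    { before = Z′ ; after = Y ; split = ∷ʳ-++ Z′ E Y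
    ; positive = pos ; atMost-b = low ; stable = stable }

  module _ (X Y₁ : List Step) (above : ∀ C c D → Y₁ ≡ C ++ c ∷ D → + b ℤ.< height (X ++ C)) where

    firstLowPoint-positive : 0ℤ ℤ.< height X → 0ℤ ℤ.< height (X ++ Y₁)
    firstLowPoint-positive pos with initLast Y₁
    ... | []      = subst (0ℤ ℤ.<_) (cong height (sym (++-identityʳ X))) pos
    ... | C ∷ʳ′ c = begin-strict
      0ℤ                            ≡⟨ sym (ℤP.+-inverseʳ (+ b)) ⟩
      + b ℤ.- + b                   <⟨ ℤP.+-mono-<-≤ (above C c [] refl) (-b≤weight c) ⟩
      height (X ++ C) ℤ.+ weight c  ≡⟨ sym (height-∷ʳ (X ++ C) c) ⟩
      height ((X ++ C) ∷ʳ c)        ≡⟨ cong height (++-assoc X C [ c ]) ⟩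
      height (X ++ C ∷ʳ c)          ∎
      where open ℤP.≤-Reasoning

    firstLowPoint-lowest : height (X ++ Y₁) ℤ.≤ + b → EndsAtLowest Y₁
    firstLowPoint-lowest _   C []      eq = ℤP.≤-reflexive (cong height (trans eq (++-identityʳ C)))
    firstLowPoint-lowest low C (c ∷ D) eq = ℤP.<⇒≤ (+-cancelˡ-< (height X)
      (subst₂ ℤ._<_ (height-++ X Y₁) (height-++ X C) (ℤP.≤-<-trans low (above C c D eq))))

  lowEastCut : .{{NonZero a}} → ∀ {k} X Y → height (X ++ Y) ≡ 0ℤ → 0ℤ ℤ.< height X →
               KStable′ k (Y ++ X) → LowEastCut k (X ++ Y)
  lowEastCut {k} X Y closed pos stable
    with Y₁ , Y₂ , refl , low , notLow ← shortestPrefix (λ Z → height (X ++ Z) ℤP.≤? + b) Y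
                                           (subst (ℤ._≤ + b) (sym closed) (+≤+ z≤n))
    = subst (LowEastCut k) (++-assoc X Y₁ Y₂)
        (lowEastCutAt (X ++ Y₁) Y₂ closed′ (firstLowPoint-positive X Y₁ above pos) low stable′)
    where
    above : ∀ C c D → Y₁ ≡ C ++ c ∷ D → + b ℤ.< height (X ++ C)
    above C c D eq = ℤP.≰⇒> (notLow C c D eq)
    closed′ : height ((X ++ Y₁) ++ Y₂) ≡ 0ℤ
    closed′ = trans (cong height (++-assoc X Y₁ Y₂)) closed
    closedY₁ : height (Y₁ ++ Y₂ ++ X) ≡ 0ℤ
    closedY₁ = trans (cong height (sym (++-assoc Y₁ Y₂ X))) (trans (height-++-comm (Y₁ ++ Y₂) X) closed)
    stable′ : KStable′ k (Y₂ ++ X ++ Y₁)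
    stable′ = subst (KStable′ k) (++-assoc Y₂ X Y₁)
      (KStable′-rotate Y₁ (Y₂ ++ X) closedY₁ (firstLowPoint-lowest X Y₁ above low)
        (subst (KStable′ k) (++-assoc Y₁ Y₂ X) stable))

  stableRotation⇒LowEastCut : .{{NonZero a}} → ∀ {k} Q i → IsPath a b Q →
                              0ℤ ℤ.< level a b (pointAt Q i) → KStable a b k (rotate i Q) → LowEastCut k Q
  stableRotation⇒LowEastCut {k} Q i path pos stable =
    subst (LowEastCut k) (take++drop≡id i Q)
      (lowEastCut (take i Q) (drop i Q) (trans (cong height (take++drop≡id i Q)) (IsPath⇒height≡0 Q path))
        (subst (0ℤ ℤ.<_) (level-pointAt Q i) pos) (KStable⇒KStable′ (rotate i Q) stable))

¬KSkeletal⇒stableRotation : ∀ a b k Q → KStable a b k Q → ¬ KSkeletal a b k Q →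
                            ∃[ i ] (0ℤ ℤ.< level a b (pointAt Q i) × KStable a b k (rotate i Q))
¬KSkeletal⇒stableRotation a b k Q stable ¬skeletal
  with anyUpTo? (λ i → (0ℤ ℤP.<? level a b (pointAt Q i)) ×-dec KStable? a b k (rotate i Q))
                (suc (length Q))
... | yes (i , _ , rotation) = i , rotation
... | no none =
  ⊥-elim (¬skeletal (stable , λ i i≤L pos rotStable → none (i , s≤s i≤L , pos , rotStable)))

q*n≤m<[1+q]*n⇒m/n≡q : ∀ {m n q} .{{_ : NonZero n}} → q * n ≤ m → m < suc q * n → m / n ≡ q
q*n≤m<[1+q]*n⇒m/n≡q {m} {n} {q} lower upper =
  ≤-antisym (≤-pred (m<n*o⇒m/o<n upper)) (subst (_≤ m / n) (m*n/n≡m q n) (/-monoˡ-≤ n lower))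

MinLevelRotation : (a b k : ℕ) → .{{NonZero b}} → List Step → Set
MinLevelRotation a b k Q =
  ∃[ s ] (1 ≤ s × s ≤ b ×
    ∃[ j ] (suc j ≤ length Q × pointAt Q (suc j) ≡ vmin a b s ×
            Q !! j ≡ just E × KStable a b k (rotate (suc j) Q)))

module _ (a b : ℕ) .{{_ : NonZero a}} .{{_ : NonZero b}} (coprime : Coprime a b) where

  b∤a*s : ∀ {s} → 0 < s → s < b → b ∤ a * s
  b∤a*s 0<s s<b b∣a*s =
    <⇒≱ s<b (∣⇒≤ {{>-nonZero 0<s}} (coprime-divisor (Coprimality.sym coprime) b∣a*s))

  vmin-level-positive : ∀ s → 1 ≤ s → s ≤ b → 0ℤ ℤ.< level a b (vmin a b s)
  vmin-level-positive s 1≤s _ with s <? b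
  ... | yes s<b = n<m⇒0<+m-+n (≤∧≢⇒< b*q≤a*s b*q≢a*s)
    where
    q = (s * a) / b
    b*q≤a*s : b * q ≤ a * s
    b*q≤a*s = subst₂ _≤_ (*-comm q b) (*-comm s a) (m/n*n≤m (s * a) b)
    b*q≢a*s : b * q ≢ a * s
    b*q≢a*s eq = b∤a*s 1≤s s<b (divides q (trans (sym eq) (*-comm b q)))
  ... | no _ = n<m⇒0<+m-+n (subst (b * (a ∸ 1) <_) (*-comm b a) (*-monoʳ-< b a∸1<a))
    where
    a∸1<a : a ∸ 1 < a
    a∸1<a = ∸-monoʳ-< (s≤s z≤n) (>-nonZero⁻¹ a)

  low-point≡vmin : ∀ x y → y ≤ b → b * x < a * y → a * y ≤ b * x + b →
                   1 ≤ y × vmin a b y ≡ (x , y)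
  low-point≡vmin x zero      _   bx<a0 _ = ⊥-elim (n≮0 (subst (b * x <_) (*-zeroʳ a) bx<a0))
  low-point≡vmin x y@(suc _) y≤b bx<ay ay≤bx+b with y <? b
  ... | yes y<b = s≤s z≤n , cong (_, y) (q*n≤m<[1+q]*n⇒m/n≡q lower upper)
    where
    lower : x * b ≤ y * a
    lower = subst₂ _≤_ (*-comm b x) (*-comm a y) (<⇒≤ bx<ay)
    bx+b≡[1+x]*b : b * x + b ≡ suc x * b
    bx+b≡[1+x]*b = trans (+-comm (b * x) b) (cong (λ n → b + n) (*-comm b x))
    upper : y * a < suc x * b
    upper = ≤∧≢⇒< (subst₂ _≤_ (*-comm a y) bx+b≡[1+x]*b ay≤bx+b)
                  (λ eq → b∤a*s (s≤s z≤n) y<b (divides (suc x) (trans (*-comm a y) eq)))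
  ... | no y≮b = s≤s z≤n , cong₂ _,_ (cong (_∸ 1) (≤-antisym a≤1+x x<a)) (sym y≡b)
    where
    y≡b : y ≡ b
    y≡b = ≤-antisym y≤b (≮⇒≥ y≮b)
    ay≡ba : a * y ≡ b * a
    ay≡ba = trans (cong (a *_) y≡b) (*-comm a b)
    x<a : x < a
    x<a = *-cancelˡ-< b x a (subst (b * x <_) ay≡ba bx<ay)
    a≤1+x : a ≤ suc x
    a≤1+x = *-cancelˡ-≤ b (subst₂ _≤_ ay≡ba (trans (+-comm (b * x) b) (sym (*-suc b x))) ay≤bx+b)

  MinLevelRotation⇒¬KSkeletal : ∀ {k} Q → MinLevelRotation a b k Q → ¬ KSkeletal a b k Q
  MinLevelRotation⇒¬KSkeletal Q (s , 1≤s , s≤b , j , j<L , atVmin , _ , stable) (_ , rigid) =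
    rigid (suc j) j<L (subst (λ v → 0ℤ ℤ.< level a b v) (sym atVmin) (vmin-level-positive s 1≤s s≤b))
      stable

  LowEastCut⇒MinLevelRotation : ∀ {k} Q → #N Q ≡ b → LowEastCut a b k Q → MinLevelRotation a b k Q
  LowEastCut⇒MinLevelRotation {k} _ #N≡b
    record { before = X ; after = Y ; split = refl ; positive = pos ; atMost-b = low ; stable = stable }
    = #N X′ , proj₁ atVmin , s≤b , length X , !!-just⇒< Q (length X) east
    , trans (cong (λ Z → (#E Z , #N Z)) (take-suc-length-++ X E Y)) (sym (proj₂ atVmin))
    , east , subst (KStable a b k) (sym rotation) (KStable′⇒KStable a b (Y ++ X′) stable)
    where
    Q  = X ++ E ∷ Y
    X′ = X ∷ʳ E
    east : Q !! length X ≡ just E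
    east = !!-length-++ X E Y
    rotation : rotate (suc (length X)) Q ≡ Y ++ X′
    rotation = cong₂ _++_ (drop-suc-length-++ X E Y) (take-suc-length-++ X E Y)
    s≤b : #N X′ ≤ b
    s≤b = subst (#N X′ ≤_) (trans (cong #N (∷ʳ-++ X E Y)) #N≡b) (#N-++-≤ˡ X′ Y)
    levelX′ : level a b (#E X′ , #N X′) ≡ height a b X′
    levelX′ = level≡height a b X′
    atVmin : 1 ≤ #N X′ × vmin a b (#N X′) ≡ (#E X′ , #N X′)
    atVmin = low-point≡vmin (#E X′) (#N X′) s≤b
               (0<+m-+n⇒n<m (subst (0ℤ ℤ.<_) (sym levelX′) pos))
               (+m-+n≤+c⇒m≤n+c (subst (ℤ._≤ + b) (sym levelX′) low))

lemma4p3 : (a b k : ℕ) → .{{_ : NonZero a}} → .{{_ : NonZero b}} →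
    Coprime a b → k < b →
    (Q : List Step) → IsPath a b Q → KStable a b k Q →
    (¬ KSkeletal a b k Q) ⇔
      (∃[ s ] (1 ≤ s × s ≤ b ×
        ∃[ j ] (suc j ≤ length Q × pointAt Q (suc j) ≡ vmin a b s ×
                Q !! j ≡ just E × KStable a b k (rotate (suc j) Q))))
lemma4p3 a b k coprime _ Q path stable = mk⇔ to (MinLevelRotation⇒¬KSkeletal a b coprime Q)
  where
  to : ¬ KSkeletal a b k Q → MinLevelRotation a b k Q
  to ¬skeletal =
    let i , pos , rotStable = ¬KSkeletal⇒stableRotation a b k Q stable ¬skeletal
    in LowEastCut⇒MinLevelRotation a b coprime Q (proj₂ path)
         (stableRotation⇒LowEastCut a b Q i path pos rotStable)
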